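{- Let $G=(V,E)$ be a finite loopless multigraph and let $(L,C)$ be a derangement assignment on $G$. If there exists a biorientation $D$ of $G$ such that $E_T(G)\subseteq E_{D2}(G)$, $|L(v)|\geq d^+_D(v)+1$ for each $v\in V$, and every odd directed cycle of $D$ contains (an arc coming from) a twisted edge, then $G$ is $(L,C)$-colorable.
   Context: A biorientation of $G$ is a digraph $D$ on $V(G)$ in which each edge $e=\{u,v\}$ of $G$ is replaced by the arc $(u,v)$, the arc $(v,u)$, or both (and there are no other arcs). $E_{D2}(G)$ is the set of edges of $G$ oriented in both directions in $D$; $d^+_D(v)$ is the out-degree of $v$ in $D$. A correspondence assignment $(L,C)$ for $G$ consists of lists $L(v)$ for $v\in V$ and, for each edge $e=\{u,v\}$, a partial matching $C_e$ between $\{u\}\times L(u)$ and $\{v\}\times L(v)$. An $(L,C)$-coloring is a function $\varphi$ with $\varphi(v)\in L(v)$ for all $v$ such that for every edge $e=\{u,v\}$, $(u,\varphi(u))$ and $(v,\varphi(v))$ are not matched in $C_e$. An edge $e=\{u,v\}$ is straight if $\{(u,c_1),(v,c_2)\}\in C_e$ implies $c_1=c_2$, and twisted otherwise; $E_T(G)$ is the set of twisted edges. $C_e$ (for $e=\{v,w\}$) is a partial derangement if $\{(v,c),(w,c)\}\notin C_e$ for all $c\in L(v)\cap L(w)$. $(L,C)$ is a derangement assignment if $C_e$ is a partial derangement for every twisted edge $e$. -}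

module Defs where

open import Data.Nat using (ℕ; suc; _+_; _≤_)
open import Data.Fin using (Fin; zero; suc; inject₁; fromℕ; _≟_)
open import Data.Fin.Properties using ()
open import Data.List using (List; []; _∷_; length; filter; concatMap; map)
open import Data.List.Membership.Propositional using (_∈_; _∉_)
open import Data.List.Relation.Unary.All using (All)
open import Data.List.Relation.Unary.Any using (Any)
open import Data.List.Relation.Unary.Unique.Propositional using (Unique)
open import Data.List.Base using (allFin)
open import Data.Product using (Σ; _×_; _,_; proj₁; proj₂; ∃)
open import Function using (_∘_)
open import Function.Definitions using (Injective)
open import Relation.Binary.PropositionalEquality using (_≡_; _≢_)
open import Relation.Nullary using (¬_)

record Multigraph : Set where
  field
    n : ℕ
    m : ℕ
    ends : Fin m → Fin n × Fin n
    loopless : ∀ e → proj₁ (ends e) ≢ proj₂ (ends e)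

  Vertex : Set
  Vertex = Fin n

  Edge : Set
  Edge = Fin m

  end₁ end₂ : Edge → Vertex
  end₁ e = proj₁ (ends e)
  end₂ e = proj₂ (ends e)

open Multigraph public

Odd : ℕ → Set
Odd k = ∃ λ j → k ≡ suc (j + j)

Colour : Set
Colour = ℕ

-- A correspondence assignment (L , C): L v is the (duplicate-free) list of
-- colours of v; C e is a list of pairs (c₁ , c₂), meaning (end₁ e , c₁) is
-- matched with (end₂ e , c₂) in C_e.
record CorrespondenceAssignment (G : Multigraph) : Set where
  field
    L : Vertex G → List Colour
    L-unique : ∀ v → Unique (L v)
    C : Edge G → List (Colour × Colour)
    C-in-lists : ∀ e → All (λ p → proj₁ p ∈ L (end₁ G e) × proj₂ p ∈ L (end₂ G e)) (C e)
    -- partial matching: each colour of each endpoint occurs in at most one pair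
    C-matching₁ : ∀ e → Unique (map proj₁ (C e))
    C-matching₂ : ∀ e → Unique (map proj₂ (C e))

open CorrespondenceAssignment public

module _ {G : Multigraph} (LC : CorrespondenceAssignment G) where

  IsColouring : (Vertex G → Colour) → Set
  IsColouring φ =
    (∀ v → φ v ∈ L LC v) ×
    (∀ e → (φ (end₁ G e) , φ (end₂ G e)) ∉ C LC e)

  Colourable : Set
  Colourable = Σ (Vertex G → Colour) IsColouring

  Straight : Edge G → Set
  Straight e = ∀ c₁ c₂ → (c₁ , c₂) ∈ C LC e → c₁ ≡ c₂

  Twisted : Edge G → Set
  Twisted e = ¬ Straight e

  PartialDerangement : Edge G → Set
  PartialDerangement e =
    ∀ c → c ∈ L LC (end₁ G e) → c ∈ L LC (end₂ G e) → (c , c) ∉ C LC e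

  IsDerangementAssignment : Set
  IsDerangementAssignment = ∀ e → Twisted e → PartialDerangement e

-- Biorientations: each edge oriented end₁→end₂ (fwd), end₂→end₁ (bwd), or both.
data Orientation : Set where
  fwd bwd both : Orientation

Biorientation : Multigraph → Set
Biorientation G = Edge G → Orientation

data Dir : Set where
  forward backward : Dir

Arc : Multigraph → Set
Arc G = Edge G × Dir

module _ {G : Multigraph} where

  tail head : Arc G → Vertex G
  tail (e , forward) = end₁ G e
  tail (e , backward) = end₂ G e
  head (e , forward) = end₂ G e
  head (e , backward) = end₁ G e

  InD : Biorientation G → Arc G → Set
  InD D (e , forward) = D e ≢ bwd
  InD D (e , backward) = D e ≢ fwd

  InED2 : Biorientation G → Edge G → Set
  InED2 D e = D e ≡ both

  arcsOf : Biorientation G → Edge G → List (Arc G)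
  arcsOf D e with D e
  ... | fwd = (e , forward) ∷ []
  ... | bwd = (e , backward) ∷ []
  ... | both = (e , forward) ∷ (e , backward) ∷ []

  arcs : Biorientation G → List (Arc G)
  arcs D = concatMap (arcsOf D) (allFin (m G))

  outdeg : Biorientation G → Vertex G → ℕ
  outdeg D v = length (filter (λ a → tail a ≟ v) (arcs D))

  record DirectedCycle (D : Biorientation G) (k : ℕ) : Set where
    field
      x : Fin (suc k) → Vertex G
      a : Fin k → Arc G
      a-in-D : ∀ i → InD D (a i)
      a-tail : ∀ i → tail (a i) ≡ x (inject₁ i)
      a-head : ∀ i → head (a i) ≡ x (suc i)
      closed : x (fromℕ k) ≡ x zero
      distinct : Injective _≡_ _≡_ (x ∘ inject₁)

  open DirectedCycle public

  OddCyclesTwisted : CorrespondenceAssignment G → Biorientation G → Set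
  OddCyclesTwisted LC D =
    ∀ k → Odd k → (Z : DirectedCycle D k) →
      ∃ λ (i : Fin k) → Twisted LC (proj₁ (a Z i))

module Submission where

open import Defs
open import Data.Nat using (suc; _≤_)
open import Data.List using (length)

-- Induction on the set R of uncoloured vertices, each v ∈ R carrying a sublist L′ v of L v
-- longer than the number of arcs of D from v into R.  Pick v₀ ∈ R and c ∈ L′ v₀, and call an arc
-- of D monochromatic if it joins two vertices of R having c available and c is matched to c
-- along it.  Twisted edges are partial derangements, so monochromatic arcs come from straight
-- edges; by hypothesis they form a digraph with no odd cycle, hence no odd closed walk, and so it
-- has a nonempty semikernel K.  Colour K with c and delete from each remaining list the colours
-- matched to c along an arc of D into K: an arc deletes at most one colour, so the degree
-- condition survives on R ─ K.  A conflict along an edge oriented only from K towards w is across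
-- a straight edge, so it concerns c itself, and absorption gives an arc of D from w into K which
-- already deleted c.

open import Data.Nat as ℕ using (ℕ; zero; _+_; _<_; z≤n; s≤s; s≤s⁻¹; _≤?_)
open import Data.Nat.Base using (parity)
open import Data.Nat.Properties
  using (+-suc; +-comm; +-mono-≤; +-monoˡ-≤; +-monoʳ-≤; +-cancelʳ-≤; ≤-reflexive; ≤-trans;
         ≤-<-trans; <⇒≤; ≰⇒>; m≤n⇒∃[o]m+o≡n; m<m+n; m≤n+m; n<1+n; module ≤-Reasoning)
open import Data.Nat.Tactic.RingSolver using (solve-∀)
open import Data.Nat.Induction using (<-wellFounded)
open import Induction.WellFounded using (Acc; acc)
open import Data.Parity using (0ℙ; 1ℙ; _⁻¹)
import Data.Parity.Properties as ℙ
open import Data.Fin as Fin using (Fin; toℕ)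
open import Data.Fin.Properties as Finₚ
  using (pigeonhole; toℕ<n; any?; toℕ-inject₁; toℕ-fromℕ)
open import Data.Fin.Subset using (Subset; Nonempty; ⊤; outside; _─_; _⊂_; ∣_∣)
  renaming (_∈_ to _∈ₛ_; _⊆_ to _⊆ₛ_)
open import Data.Fin.Subset.Properties
  using (∈⊤; nonempty?; x∈p∩q⁺; x∈p∧x∉q⇒x∈p─q; p─q⊆p; p∩q≢∅⇒∣p─q∣<∣p∣; p⊂q⇒∣p∣<∣q∣)
  renaming (_∈?_ to _∈ₛ?_)
open import Data.Vec using (_∷_; tabulate)
open import Data.Vec.Base using (here; there)
open import Data.Vec.Properties using (lookup⇒[]=; []=⇒lookup; lookup∘tabulate)
open import Data.List using (List; []; _∷_; filter; map; concatMap; allFin)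
open import Data.List.Properties
  using (filter-all; filter-≐; filter-none; length-++; length-map; length-removeAt′; map-∘)
open import Data.List.Membership.Propositional using (_∈_; _∉_; find; lose)
open import Data.List.Membership.Propositional.Properties
  using (∈-allFin; ∈-concatMap⁺; ∈-concatMap⁻; ∈-map⁺; ∈-map⁻; ∈-filter⁺; ∈-filter⁻)
import Data.List.Membership.DecPropositional as DecMembership
open import Data.List.Relation.Unary.All as All using (All)
open import Data.List.Relation.Unary.All.Properties using (map⁻)
open import Data.List.Relation.Unary.Any as Any using (Any; here; there)
open import Data.List.Relation.Unary.AllPairs using (_∷_)
open import Data.List.Relation.Unary.Unique.Propositional using (Unique)
import Data.List.Relation.Unary.Unique.Propositional.Properties as Unique
open import Data.List.Relation.Binary.Subset.Propositional using (_⊆_)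
open import Data.Product using (Σ; ∃; ∃₂; _×_; _,_; proj₁; proj₂; map₁; swap)
open import Data.Product.Properties using (≡-dec)
open import Data.Sum using (_⊎_; inj₁; inj₂)
open import Function using (id; _∘_)
open import Relation.Nullary using (Dec; yes; no; does; ¬_; contradiction)
open import Relation.Nullary.Decidable using (_×-dec_; ¬?; dec-true)
open import Relation.Unary using (Pred; Decidable; _∪_; ∁)
open import Relation.Unary.Properties using (_∪?_; ∁?)
open import Relation.Binary using (DecidableEquality; tri<; tri≈; tri>)
open import Relation.Binary.PropositionalEquality using (_≡_; _≢_; refl; sym; trans; cong; subst)

open DecMembership ℕ._≟_ using () renaming (_∈?_ to _∈ᶜ?_)
open DecMembership (≡-dec ℕ._≟_ ℕ._≟_) using () renaming (_∈?_ to _∈ᵖ?_)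

module _ {a} {A : Set a} where

  length-filter-∪ : ∀ {p q} {P : Pred A p} {Q : Pred A q} (P? : Decidable P) (Q? : Decidable Q) →
    (∀ {x} → P x → ¬ Q x) →
    ∀ xs → length (filter (P? ∪? Q?) xs) ≡ length (filter P? xs) + length (filter Q? xs)
  length-filter-∪ P? Q? disjoint [] = refl
  length-filter-∪ P? Q? disjoint (x ∷ xs) with P? x | Q? x
  ... | yes px | yes qx = contradiction qx (disjoint px)
  ... | yes _  | no _   = cong suc (length-filter-∪ P? Q? disjoint xs)
  ... | no _   | yes _  = trans (cong suc (length-filter-∪ P? Q? disjoint xs)) (sym (+-suc _ _))
  ... | no _   | no _   = length-filter-∪ P? Q? disjoint xs

  length-filter-∁ : ∀ {p} {P : Pred A p} (P? : Decidable P) →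
    ∀ xs → length xs ≡ length (filter P? xs) + length (filter (∁? P?) xs)
  length-filter-∁ {P = P} P? xs = trans
    (cong length (sym (filter-all (P? ∪? ∁? P?) (All.universal excluded-middle xs))))
    (length-filter-∪ P? (∁? P?) (λ px ¬px → ¬px px) xs)
    where
    excluded-middle : ∀ x → (P ∪ ∁ P) x
    excluded-middle x with P? x
    ... | yes px = inj₁ px
    ... | no ¬px = inj₂ ¬px

  ∈-─ : ∀ {x y} {ys : List A} (y∈ys : y ∈ ys) → x ∈ ys → x ≢ y → x ∈ (ys Any.─ y∈ys)
  ∈-─ (here refl)  (here refl)  x≢y = contradiction refl x≢y
  ∈-─ (here _)     (there x∈ys) _   = x∈ys
  ∈-─ (there _)    (here refl)  _   = here refl
  ∈-─ (there y∈ys) (there x∈ys) x≢y = there (∈-─ y∈ys x∈ys x≢y)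

  Unique-⊆⇒length≤ : ∀ {xs ys : List A} → Unique xs → xs ⊆ ys → length xs ≤ length ys
  Unique-⊆⇒length≤ {[]}     _                _     = z≤n
  Unique-⊆⇒length≤ {x ∷ xs} {ys} (x∉xs ∷ unique) xs⊆ys = begin
    suc (length xs)              ≤⟨ s≤s (Unique-⊆⇒length≤ unique xs⊆ys─x) ⟩
    suc (length (ys Any.─ x∈ys)) ≡⟨ sym (length-removeAt′ ys _) ⟩
    length ys                    ∎
    where
    open ≤-Reasoning
    x∈ys = xs⊆ys (here refl)
    xs⊆ys─x : xs ⊆ (ys Any.─ x∈ys)
    xs⊆ys─x y∈xs =
      ∈-─ x∈ys (xs⊆ys (there y∈xs)) (λ y≡x → All.lookup x∉xs y∈xs (sym y≡x))

module _ {a} {A : Set a} (_≟_ : DecidableEquality A) where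
  open DecMembership _≟_ using (_∈?_)

  length≤filter-∉+length : ∀ {xs} → Unique xs → ∀ ys →
    length xs ≤ length (filter (λ x → ¬? (x ∈? ys)) xs) + length ys
  length≤filter-∉+length {xs} unique ys = begin
    length xs                                           ≡⟨ length-filter-∁ (_∈? ys) xs ⟩
    length (filter (_∈? ys) xs) + length (filter (λ x → ¬? (x ∈? ys)) xs)
      ≤⟨ +-monoˡ-≤ _ (Unique-⊆⇒length≤ (Unique.filter⁺ (_∈? ys) unique)
                                        (proj₂ ∘ ∈-filter⁻ (_∈? ys) {xs = xs})) ⟩
    length ys + length (filter (λ x → ¬? (x ∈? ys)) xs) ≡⟨ +-comm (length ys) _ ⟩
    length (filter (λ x → ¬? (x ∈? ys)) xs) + length ys ∎
    where open ≤-Reasoning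

module _ {a b} {A : Set a} {B : Set b} where

  length-concatMap-≤ : (f : A → List B) → (∀ x → length (f x) ≤ 1) →
                       ∀ xs → length (concatMap f xs) ≤ length xs
  length-concatMap-≤ f short [] = z≤n
  length-concatMap-≤ f short (x ∷ xs) = subst (_≤ suc (length xs)) (sym (length-++ (f x)))
    (+-mono-≤ (short x) (length-concatMap-≤ f short xs))

  length-filter-fibre-≤1 : (f : A → B) (_≟ᴮ_ : DecidableEquality B) {y : B} →
    ∀ xs → Unique (map f xs) → length (filter (λ x → f x ≟ᴮ y) xs) ≤ 1
  length-filter-fibre-≤1 f _≟ᴮ_ [] _ = z≤n
  length-filter-fibre-≤1 f _≟ᴮ_ {y} (x ∷ xs) (fx∉ ∷ unique) with f x ≟ᴮ y
  ... | yes fx≡y = s≤s (≤-reflexive (cong length (filter-none (λ x′ → f x′ ≟ᴮ y)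
                     (All.map (λ fx≢fx′ fx′≡y → fx≢fx′ (trans fx≡y (sym fx′≡y))) (map⁻ fx∉)))))
  ... | no _ = length-filter-fibre-≤1 f _≟ᴮ_ xs unique

1≤length⇒∃∈ : ∀ {a} {A : Set a} {xs : List A} → 1 ≤ length xs → ∃ (_∈ xs)
1≤length⇒∃∈ {xs = x ∷ _} _ = x , here refl

module _ {n : ℕ} {p} {P : Pred (Fin n) p} (P? : Decidable P) where

  subset : Subset n
  subset = tabulate (does ∘ P?)

  ∈-subset⁺ : ∀ {v} → P v → v ∈ₛ subset
  ∈-subset⁺ {v} pv = lookup⇒[]= v subset (trans (lookup∘tabulate _ v) (dec-true (P? v) pv))

  ∈-subset⁻ : ∀ {v} → v ∈ₛ subset → P v
  ∈-subset⁻ {v} v∈ with P? v | trans (sym (lookup∘tabulate (does ∘ P?) v)) ([]=⇒lookup v∈)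
  ... | yes pv | _ = pv

x∈p─q⇒x∉q : ∀ {n} {x : Fin n} (p q : Subset n) → x ∈ₛ p ─ q → ¬ x ∈ₛ q
x∈p─q⇒x∉q (_ ∷ p) (outside ∷ q) here       ()
x∈p─q⇒x∉q (_ ∷ p) (_ ∷ q)       (there x∈) (there x∈q) = x∈p─q⇒x∉q p q x∈ x∈q

suc+-reassoc : ∀ i d e → suc i + d + e ≡ i + (suc d + e)
suc+-reassoc = solve-∀

suc+-swap : ∀ i d e → suc i + d + e ≡ i + e + suc d
suc+-swap = solve-∀

parity-+1 : ∀ k {π} → parity k ≡ π → parity (k + 1) ≡ π ⁻¹
parity-+1 k refl rewrite ℙ.+-homo-+ k 1 with parity k
... | 0ℙ = refl
... | 1ℙ = refl

parity-+-odd : ∀ k l → parity (k + l) ≡ 1ℙ → parity k ≡ 1ℙ ⊎ parity l ≡ 1ℙ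
parity-+-odd k l odd rewrite ℙ.+-homo-+ k l with parity k | parity l
... | 1ℙ | _  = inj₁ refl
... | 0ℙ | 1ℙ = inj₂ refl
... | 0ℙ | 0ℙ = contradiction odd λ ()

parity≡1ℙ⇒Odd : ∀ k → parity k ≡ 1ℙ → Odd k
parity≡1ℙ⇒Odd 0 ()
parity≡1ℙ⇒Odd 1 _ = 0 , refl
parity≡1ℙ⇒Odd (suc (suc k)) odd with j , refl ← parity≡1ℙ⇒Odd k odd =
  suc j , cong (suc ∘ suc) (sym (+-suc j j))

module Digraph {nv : ℕ} (_⟶_ : Fin nv → Fin nv → Set) (_⟶?_ : ∀ u v → Dec (u ⟶ v)) where

  infixr 5 _◅_ _◅◅_

  data Walk : Fin nv → Fin nv → ℕ → Set where
    ε   : ∀ {v} → Walk v v 0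
    _◅_ : ∀ {u w v k} → u ⟶ w → Walk w v k → Walk u v (suc k)

  _◅◅_ : ∀ {u v w k l} → Walk u v k → Walk v w l → Walk u w (k + l)
  ε       ◅◅ q = q
  (a ◅ p) ◅◅ q = a ◅ (p ◅◅ q)

  _▻_ : ∀ {u v w k} → Walk u v k → v ⟶ w → Walk u w (k + 1)
  p ▻ a = p ◅◅ (a ◅ ε)

  vertexAt : ∀ {u v k} → Walk u v k → ℕ → Fin nv
  vertexAt {u} ε       _       = u
  vertexAt {u} (_ ◅ _) zero    = u
  vertexAt     (_ ◅ p) (suc i) = vertexAt p i

  vertexAt-start : ∀ {u v k} (p : Walk u v k) → vertexAt p 0 ≡ u
  vertexAt-start ε       = refl
  vertexAt-start (_ ◅ _) = refl

  vertexAt-end : ∀ {u v k} (p : Walk u v k) → vertexAt p k ≡ v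
  vertexAt-end ε       = refl
  vertexAt-end (_ ◅ p) = vertexAt-end p

  arcAt : ∀ {u v k} (p : Walk u v k) (i : Fin k) → vertexAt p (toℕ i) ⟶ vertexAt p (suc (toℕ i))
  arcAt (a ◅ ε)       Fin.zero    = a
  arcAt (a ◅ (_ ◅ _)) Fin.zero    = a
  arcAt (_ ◅ p)       (Fin.suc i) = arcAt p i

  splitAt : ∀ i {u v k} (p : Walk u v (i + k)) →
            Walk u (vertexAt p i) i × Walk (vertexAt p i) v k
  splitAt zero    ε       = ε , ε
  splitAt zero    (a ◅ p) = ε , a ◅ p
  splitAt (suc i) (a ◅ p) = map₁ (a ◅_) (splitAt i p)

  vertexAt-splitAt : ∀ i {u v k} (p : Walk u v (i + k)) t →
                     vertexAt (proj₂ (splitAt i p)) t ≡ vertexAt p (i + t)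
  vertexAt-splitAt zero    ε       t = refl
  vertexAt-splitAt zero    (a ◅ p) t = refl
  vertexAt-splitAt (suc i) (a ◅ p) t = vertexAt-splitAt i p t

  excise : ∀ i d {e u v k} (p : Walk u v k) → k ≡ i + (d + e) →
           vertexAt p i ≡ vertexAt p (i + d) →
           Walk u v (i + e) × Walk (vertexAt p i) (vertexAt p i) d
  excise i d {e} {v = v} p refl repeated =
    before ◅◅ subst (λ x → Walk x v e) returns after ,
    subst (λ y → Walk (vertexAt p i) y d) returns loop
    where
    before = proj₁ (splitAt i p)
    loop   = proj₁ (splitAt d (proj₂ (splitAt i p)))
    after  = proj₂ (splitAt d (proj₂ (splitAt i p)))
    returns : vertexAt (proj₂ (splitAt i p)) d ≡ vertexAt p i
    returns = trans (vertexAt-splitAt i p d) (sym repeated)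

  excise-at : ∀ {u v k i j} (p : Walk u v k) → i < j → j ≤ k → vertexAt p i ≡ vertexAt p j →
              ∃₂ λ l d → l + suc d ≡ k × suc d ≤ j ×
                         Walk u v l × Walk (vertexAt p i) (vertexAt p i) (suc d)
  excise-at {i = i} p i<j j≤k repeated
    with d , refl ← m≤n⇒∃[o]m+o≡n i<j | e , refl ← m≤n⇒∃[o]m+o≡n j≤k
    with rest , loop ← excise i (suc d) p (suc+-reassoc i d e)
                         (subst (λ t → vertexAt p i ≡ vertexAt p t) (sym (+-suc i d)) repeated)
    = i + e , d , sym (suc+-swap i d e) , s≤s (m≤n+m d i) , rest , loop

  Reachable : Fin nv → Fin nv → Set
  Reachable u v = ∃ (Walk u v)

  reachable-trans : ∀ {u v w} → Reachable u v → Reachable v w → Reachable u w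
  reachable-trans (_ , p) (_ , q) = _ , p ◅◅ q

  shorten : ∀ {u v k} → Acc _<_ k → Walk u v k → ∃ λ l → l ≤ nv × Walk u v l
  shorten {k = k} (acc shorter) p with k ≤? nv
  ... | yes k≤nv = k , k≤nv , p
  ... | no k≰nv
    with i , j , i<j , repeated ← pigeonhole (n<1+n nv) (λ t → vertexAt p (toℕ t))
    with l , _ , l+d≡k , _ , p′ , _ ←
           excise-at p i<j (≤-trans (s≤s⁻¹ (toℕ<n j)) (<⇒≤ (≰⇒> k≰nv))) repeated
    = shorten (shorter (subst (l <_) l+d≡k (m<m+n l (s≤s z≤n)))) p′

  walkWithin? : ∀ t u v → Dec (∃ λ k → k ≤ t × Walk u v k)
  walkWithin? t u v with u Fin.≟ v
  ... | yes refl = yes (0 , z≤n , ε)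
  walkWithin? zero    u v | no u≢v = no λ { (.0 , z≤n , ε) → u≢v refl }
  walkWithin? (suc t) u v | no u≢v with any? (λ w → (u ⟶? w) ×-dec walkWithin? t w v)
  ... | yes (w , a , k , k≤t , p) = yes (suc k , s≤s k≤t , a ◅ p)
  ... | no ∄ = no λ { (.0 , _ , ε) → u≢v refl
                    ; (suc k , s≤s k≤t , a ◅ p) → ∄ (_ , a , k , k≤t , p) }

  reachable? : ∀ u v → Dec (Reachable u v)
  reachable? u v with walkWithin? nv u v
  ... | yes (k , _ , p) = yes (k , p)
  ... | no ∄ = no λ (k , p) → ∄ (shorten (<-wellFounded k) p)

  Terminal : Fin nv → Set
  Terminal r = ∀ {v} → Reachable r v → Reachable v r

  reachableFrom : Fin nv → Subset nv
  reachableFrom u = subset (reachable? u)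

  reachableFrom-⊂ : ∀ {u v} → Reachable u v → ¬ Reachable v u →
                    reachableFrom v ⊂ reachableFrom u
  reachableFrom-⊂ {u} {v} u⇝v v↛u =
    (λ x∈ → ∈-subset⁺ (reachable? u) (reachable-trans u⇝v (∈-subset⁻ (reachable? v) x∈))) ,
    u , ∈-subset⁺ (reachable? u) (0 , ε) , λ u∈ → v↛u (∈-subset⁻ (reachable? v) u∈)

  reachesTerminal : ∀ u → ∃ λ r → Reachable u r × Terminal r
  reachesTerminal u = descend u (<-wellFounded ∣ reachableFrom u ∣)
    where
    descend : ∀ u → Acc _<_ ∣ reachableFrom u ∣ → ∃ λ r → Reachable u r × Terminal r
    descend u (acc smaller) with any? (λ v → reachable? u v ×-dec ¬? (reachable? v u))
    ... | yes (v , u⇝v , v↛u)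
      with r , v⇝r , terminal ← descend v (smaller (p⊂q⇒∣p∣<∣q∣ (reachableFrom-⊂ u⇝v v↛u)))
      = r , reachable-trans u⇝v v⇝r , terminal
    ... | no ∄ = u , (0 , ε) , returns
      where
      returns : Terminal u
      returns {v} u⇝v with reachable? v u
      ... | yes v⇝u = v⇝u
      ... | no v↛u  = contradiction (v , u⇝v , v↛u) ∄

  record Semikernel (v₀ : Fin nv) : Set where
    field
      K           : Subset nv
      nonempty    : Nonempty K
      reachable   : ∀ {x} → x ∈ₛ K → Reachable v₀ x
      independent : ∀ {x y} → x ∈ₛ K → y ∈ₛ K → ¬ (x ⟶ y)
      absorbing   : ∀ {x y} → x ∈ₛ K → ¬ (y ∈ₛ K) → x ⟶ y → ∃ λ z → z ∈ₛ K × y ⟶ z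

  EvenClosedWalks : Set
  EvenClosedWalks = ∀ {v k} → Walk v v k → parity k ≡ 0ℙ

  -- K consists of the vertices reached from a terminal vertex r by an even walk.  Every walk
  -- from r closes up to an (even) closed walk through r, so all walks from r to a given vertex
  -- have the same parity.
  opaque
    semikernel : EvenClosedWalks → ∀ v₀ → Semikernel v₀
    semikernel even-closed v₀ with r , v₀⇝r , terminal ← reachesTerminal v₀ = record
      { K           = K
      ; nonempty    = r , ∈-subset⁺ evenFrom? (0 , refl , ε)
      ; reachable   = λ x∈K → let k , _ , p = ∈-subset⁻ evenFrom? x∈K
                              in reachable-trans v₀⇝r (k , p)
      ; independent = independent
      ; absorbing   = absorbing
      }
      where
      EvenFrom : Fin nv → Set
      EvenFrom x = ∃ λ k → parity k ≡ 0ℙ × Walk r x k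

      same-parity : ∀ {x k l} → Walk r x k → Walk r x l → parity k ≡ parity l
      same-parity {k = k} {l} p q with j , s ← terminal (_ , p) =
        ℙ.+-cancelʳ-≡ (parity j) (parity k) (parity l)
          (trans (sym (ℙ.+-homo-+ k j)) (trans (even-closed (p ◅◅ s))
            (trans (sym (even-closed (q ◅◅ s))) (ℙ.+-homo-+ l j))))

      evenFrom? : ∀ x → Dec (EvenFrom x)
      evenFrom? x with reachable? r x
      ... | no r↛x = no λ (k , _ , p) → r↛x (k , p)
      ... | yes (k , p) with parity k ℙ.≟ 0ℙ
      ...   | yes even = yes (k , even , p)
      ...   | no odd   = no λ (l , even , q) → odd (trans (same-parity p q) even)

      K : Subset nv
      K = subset evenFrom?

      independent : ∀ {x y} → x ∈ₛ K → y ∈ₛ K → ¬ (x ⟶ y)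
      independent x∈K y∈K a
        with k , even , p ← ∈-subset⁻ evenFrom? x∈K | l , even′ , q ← ∈-subset⁻ evenFrom? y∈K
        = contradiction (trans (sym (parity-+1 k even)) (trans (same-parity (p ▻ a) q) even′)) λ ()

      absorbing : ∀ {x y} → x ∈ₛ K → ¬ (y ∈ₛ K) → x ⟶ y → ∃ λ z → z ∈ₛ K × y ⟶ z
      absorbing x∈K y∉K a with k , even , p ← ∈-subset⁻ evenFrom? x∈K
                          with terminal (_ , p ▻ a)
      ... | _ , ε     = contradiction (∈-subset⁺ evenFrom? (0 , refl , ε)) y∉K
      ... | _ , b ◅ _ =
        _ , ∈-subset⁺ evenFrom? (_ , parity-+1 (k + 1) (parity-+1 k even) , (p ▻ a) ▻ b) , b

  Repeats : ∀ {u v k} → Walk u v k → Set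
  Repeats {k = k} p = ∃₂ λ (i j : Fin k) → i Fin.< j × vertexAt p (toℕ i) ≡ vertexAt p (toℕ j)

  repeats? : ∀ {u v k} (p : Walk u v k) → Dec (Repeats p)
  repeats? p = any? λ i → any? λ j →
    (i Finₚ.<? j) ×-dec (vertexAt p (toℕ i) Fin.≟ vertexAt p (toℕ j))

  record Cycle (k : ℕ) : Set where
    field
      start    : Fin nv
      walk     : Walk start start k
      distinct : ∀ {i j : Fin k} → vertexAt walk (toℕ i) ≡ vertexAt walk (toℕ j) → i ≡ j

  ¬Repeats⇒cycle : ∀ {v k} (p : Walk v v k) → ¬ Repeats p → Cycle k
  ¬Repeats⇒cycle p ∄ = record { start = _ ; walk = p ; distinct = injective }
    where
    injective : ∀ {i j} → vertexAt p (toℕ i) ≡ vertexAt p (toℕ j) → i ≡ j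
    injective {i} {j} same with Finₚ.<-cmp i j
    ... | tri< i<j _ _ = contradiction (i , j , i<j , same) ∄
    ... | tri≈ _ i≡j _ = i≡j
    ... | tri> _ _ j<i = contradiction (j , i , j<i , sym same) ∄

  oddCycle : ∀ {v k} → Acc _<_ k → Walk v v k → parity k ≡ 1ℙ →
             ∃ λ l → parity l ≡ 1ℙ × Cycle l
  oddCycle {k = k} (acc shorter) p odd with repeats? p
  ... | no ∄ = k , odd , ¬Repeats⇒cycle p ∄
  ... | yes (i , j , i<j , repeated)
    with l , d , l+d≡k , d<j , rest , loop ← excise-at p i<j (<⇒≤ (toℕ<n j)) repeated
    with parity-+-odd l (suc d) (subst (λ t → parity t ≡ 1ℙ) (sym l+d≡k) odd)
  ... | inj₁ odd-rest = oddCycle (shorter (subst (l <_) l+d≡k (m<m+n l (s≤s z≤n)))) rest odd-rest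
  ... | inj₂ odd-loop = oddCycle (shorter (≤-<-trans d<j (toℕ<n j))) loop odd-loop

module Arcs (G : Multigraph) (D : Biorientation G) where

  opposite : Dir → Dir
  opposite forward  = backward
  opposite backward = forward

  reverse : Arc G → Arc G
  reverse (e , d) = e , opposite d

  tail-reverse : ∀ a → tail {G} (reverse a) ≡ head {G} a
  tail-reverse (e , forward)  = refl
  tail-reverse (e , backward) = refl

  head-reverse : ∀ a → head {G} (reverse a) ≡ tail {G} a
  head-reverse (e , forward)  = refl
  head-reverse (e , backward) = refl

  InD-or-reverse : ∀ a → InD {G} D a ⊎ InD {G} D (reverse a)
  InD-or-reverse (e , forward) with D e
  ... | fwd  = inj₁ λ ()
  ... | bwd  = inj₂ λ ()
  ... | both = inj₁ λ ()
  InD-or-reverse (e , backward) with D e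
  ... | fwd  = inj₂ λ ()
  ... | bwd  = inj₁ λ ()
  ... | both = inj₁ λ ()

  InED2⇒InD : ∀ a → InED2 {G} D (proj₁ a) → InD {G} D a
  InED2⇒InD (e , forward)  both≡ bwd≡ = contradiction (trans (sym both≡) bwd≡) λ ()
  InED2⇒InD (e , backward) both≡ fwd≡ = contradiction (trans (sym both≡) fwd≡) λ ()

  ∈-arcsOf⁺ : ∀ a → InD {G} D a → a ∈ arcsOf {G} D (proj₁ a)
  ∈-arcsOf⁺ (e , forward) inD with D e
  ... | fwd  = here refl
  ... | bwd  = contradiction refl inD
  ... | both = here refl
  ∈-arcsOf⁺ (e , backward) inD with D e
  ... | fwd  = contradiction refl inD
  ... | bwd  = here refl
  ... | both = there (here refl)

  ∈-arcsOf⁻ : ∀ e a → a ∈ arcsOf {G} D e → InD {G} D a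
  ∈-arcsOf⁻ e a a∈ with D e in De
  ∈-arcsOf⁻ e _ (here refl)         | fwd  = λ eq → contradiction (trans (sym De) eq) λ ()
  ∈-arcsOf⁻ e _ (here refl)         | bwd  = λ eq → contradiction (trans (sym De) eq) λ ()
  ∈-arcsOf⁻ e _ (here refl)         | both = λ eq → contradiction (trans (sym De) eq) λ ()
  ∈-arcsOf⁻ e _ (there (here refl)) | both = λ eq → contradiction (trans (sym De) eq) λ ()

  ∈-arcs⁺ : ∀ {a} → InD {G} D a → a ∈ arcs {G} D
  ∈-arcs⁺ {a} inD = ∈-concatMap⁺ (arcsOf {G} D) (lose (∈-allFin (proj₁ a)) (∈-arcsOf⁺ a inD))

  ∈-arcs⁻ : ∀ {a} → a ∈ arcs {G} D → InD {G} D a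
  ∈-arcs⁻ {a} a∈ with e , _ , a∈arcsOf ← find (∈-concatMap⁻ (arcsOf {G} D) {xs = allFin (m G)} a∈)
    = ∈-arcsOf⁻ e a a∈arcsOf

  outArcs : Vertex G → List (Arc G)
  outArcs w = filter (λ a → tail {G} a Fin.≟ w) (arcs {G} D)

  headIn? : ∀ X → Decidable (λ a → head {G} a ∈ₛ X)
  headIn? X a = head {G} a ∈ₛ? X

  outArcsInto : Subset (n G) → Vertex G → List (Arc G)
  outArcsInto X w = filter (headIn? X) (outArcs w)

  outdegInto : Subset (n G) → Vertex G → ℕ
  outdegInto X w = length (outArcsInto X w)

  outdegInto-⊤ : ∀ w → outdegInto ⊤ w ≡ outdeg {G} D w
  outdegInto-⊤ w = cong length (filter-all (headIn? ⊤) (All.universal (λ _ → ∈⊤) (outArcs w)))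

  outdegInto-─ : ∀ {R K} → K ⊆ₛ R → ∀ w →
                 outdegInto R w ≡ outdegInto (R ─ K) w + outdegInto K w
  outdegInto-─ {R} {K} K⊆R w = trans
    (cong length (filter-≐ (headIn? R) (headIn? (R ─ K) ∪? headIn? K) (split , join) (outArcs w)))
    (length-filter-∪ (headIn? (R ─ K)) (headIn? K) (x∈p─q⇒x∉q R K) (outArcs w))
    where
    split : ∀ {x} → x ∈ₛ R → x ∈ₛ R ─ K ⊎ x ∈ₛ K
    split {x} x∈R with x ∈ₛ? K
    ... | yes x∈K = inj₂ x∈K
    ... | no x∉K  = inj₁ (x∈p∧x∉q⇒x∈p─q x∈R x∉K)
    join : ∀ {x} → x ∈ₛ R ─ K ⊎ x ∈ₛ K → x ∈ₛ R
    join (inj₁ x∈R─K) = p─q⊆p R K x∈R─K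
    join (inj₂ x∈K)   = K⊆R x∈K

module Correspondences {G : Multigraph} (LC : CorrespondenceAssignment G) where

  -- C read along an arc: pairs (colour at the tail , colour at the head).
  arcColours : Arc G → List (Colour × Colour)
  arcColours (e , forward)  = C LC e
  arcColours (e , backward) = map swap (C LC e)

  diagonal-arcColours⁺ : ∀ a {c} → (c , c) ∈ C LC (proj₁ a) → (c , c) ∈ arcColours a
  diagonal-arcColours⁺ (e , forward)  cc = cc
  diagonal-arcColours⁺ (e , backward) cc = ∈-map⁺ swap cc

  diagonal-arcColours⁻ : ∀ a {c} → (c , c) ∈ arcColours a → (c , c) ∈ C LC (proj₁ a)
  diagonal-arcColours⁻ (e , forward)  cc = cc
  diagonal-arcColours⁻ (e , backward) cc with _ , cc′ , refl ← ∈-map⁻ swap cc = cc′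

  straight-arcColours : ∀ a {c d} → Straight LC (proj₁ a) → (d , c) ∈ arcColours a → d ≡ c
  straight-arcColours (e , forward)  straight dc = straight _ _ dc
  straight-arcColours (e , backward) straight dc with (x , y) , xy , refl ← ∈-map⁻ swap dc =
    sym (straight x y xy)

  blockedBy : Colour → Arc G → List Colour
  blockedBy c a = map proj₁ (filter (λ p → proj₂ p ℕ.≟ c) (arcColours a))

  ∈-blockedBy : ∀ a {c d} → (d , c) ∈ arcColours a → d ∈ blockedBy c a
  ∈-blockedBy a {c} dc = ∈-map⁺ proj₁ (∈-filter⁺ (λ p → proj₂ p ℕ.≟ c) dc refl)

  length-blockedBy : ∀ c a → length (blockedBy c a) ≤ 1
  length-blockedBy c a =
    subst (_≤ 1) (sym (length-map proj₁ (filter (λ p → proj₂ p ℕ.≟ c) (arcColours a))))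
      (length-filter-fibre-≤1 proj₂ ℕ._≟_ (arcColours a) (matching a))
    where
    matching : ∀ a → Unique (map proj₂ (arcColours a))
    matching (e , forward)  = C-matching₂ LC e
    matching (e , backward) = subst Unique (map-∘ (C LC e)) (C-matching₁ LC e)

  monochromatic⇒¬Twisted : IsDerangementAssignment LC → ∀ a {c} →
    c ∈ L LC (tail {G} a) → c ∈ L LC (head {G} a) → (c , c) ∈ C LC (proj₁ a) →
    ¬ Twisted LC (proj₁ a)
  monochromatic⇒¬Twisted derangement (e , forward)  c∈tail c∈head cc twisted =
    derangement e twisted _ c∈tail c∈head cc
  monochromatic⇒¬Twisted derangement (e , backward) c∈tail c∈head cc twisted =
    derangement e twisted _ c∈head c∈tail cc

module KernelColouring (G : Multigraph) (LC : CorrespondenceAssignment G)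
  (derangement : IsDerangementAssignment LC) (D : Biorientation G)
  (twisted⇒both : ∀ e → Twisted LC e → InED2 {G} D e)
  (oddCyclesTwisted : OddCyclesTwisted LC D) where

  open Arcs G D
  open Correspondences LC

  PartialColouring : Subset (n G) → (Vertex G → List Colour) → Set
  PartialColouring R L′ = Σ (Vertex G → Colour) λ φ →
    (∀ {v} → v ∈ₛ R → φ v ∈ L′ v) ×
    (∀ e → end₁ G e ∈ₛ R → end₂ G e ∈ₛ R → (φ (end₁ G e) , φ (end₂ G e)) ∉ C LC e)

  module Step (R : Subset (n G)) (L′ : Vertex G → List Colour) (L′⊆L : ∀ v → L′ v ⊆ L LC v)
              (c : Colour) (v₀ : Vertex G) (v₀∈R : v₀ ∈ₛ R) (c∈L′v₀ : c ∈ L′ v₀) where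

    Available : Vertex G → Set
    Available v = v ∈ₛ R × c ∈ L′ v

    MonochromaticArc : Vertex G → Vertex G → Arc G → Set
    MonochromaticArc u w a = tail {G} a ≡ u × head {G} a ≡ w × (c , c) ∈ C LC (proj₁ a)

    _⟶_ : Vertex G → Vertex G → Set
    u ⟶ w = Available u × Available w × Any (MonochromaticArc u w) (arcs {G} D)

    available? : ∀ v → Dec (Available v)
    available? v = (v ∈ₛ? R) ×-dec (c ∈ᶜ? L′ v)

    _⟶?_ : ∀ u w → Dec (u ⟶ w)
    u ⟶? w = available? u ×-dec available? w ×-dec Any.any? monochromatic? (arcs {G} D)
      where
      monochromatic? : ∀ a → Dec (MonochromaticArc u w a)
      monochromatic? a =
        (tail {G} a Fin.≟ u) ×-dec (head {G} a Fin.≟ w) ×-dec ((c , c) ∈ᵖ? C LC (proj₁ a))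

    open Digraph _⟶_ _⟶?_

    monochromatic-arc : ∀ {u w} a → InD {G} D a → Available u → Available w →
                        MonochromaticArc u w a → u ⟶ w
    monochromatic-arc a inD u-available w-available mono =
      u-available , w-available , lose (∈-arcs⁺ inD) mono

    arcOf : ∀ {u w} → u ⟶ w → Σ (Arc G) λ a → InD {G} D a × MonochromaticArc u w a
    arcOf (_ , _ , any) = let a , a∈arcs , mono = find any in a , ∈-arcs⁻ a∈arcs , mono

    ⟶⇒¬Twisted : ∀ {u w} (x : u ⟶ w) → ¬ Twisted LC (proj₁ (proj₁ (arcOf x)))
    ⟶⇒¬Twisted x@((_ , c∈u) , (_ , c∈w) , _) =
      let a , _ , tail≡u , head≡w , cc = arcOf x
      in monochromatic⇒¬Twisted derangement a
           (subst (λ v → c ∈ L LC v) (sym tail≡u) (L′⊆L _ c∈u))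
           (subst (λ v → c ∈ L LC v) (sym head≡w) (L′⊆L _ c∈w)) cc

    cycle⇒DirectedCycle : ∀ {k} → Cycle k → DirectedCycle {G} D k
    cycle⇒DirectedCycle {k} Z = record
      { x        = λ i → vertexAt walk (toℕ i)
      ; a        = λ i → proj₁ (arcOf (arcAt walk i))
      ; a-in-D   = λ i → proj₁ (proj₂ (arcOf (arcAt walk i)))
      ; a-tail   = λ i → trans (proj₁ (proj₂ (proj₂ (arcOf (arcAt walk i)))))
                               (cong (vertexAt walk) (sym (toℕ-inject₁ i)))
      ; a-head   = λ i → proj₁ (proj₂ (proj₂ (proj₂ (arcOf (arcAt walk i)))))
      ; closed   = trans (cong (vertexAt walk) (toℕ-fromℕ k))
                         (trans (vertexAt-end walk) (sym (vertexAt-start walk)))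
      ; distinct = λ {i} {j} same → Cycle.distinct Z
                     (trans (cong (vertexAt walk) (sym (toℕ-inject₁ i)))
                       (trans same (cong (vertexAt walk) (toℕ-inject₁ j))))
      }
      where open Cycle Z using (walk)

    evenClosedWalks : EvenClosedWalks
    evenClosedWalks {k = k} p with parity k in parity≡
    ... | 0ℙ = refl
    ... | 1ℙ with l , odd , Z ← oddCycle (<-wellFounded k) p parity≡
             with i , twisted ← oddCyclesTwisted l (parity≡1ℙ⇒Odd l odd) (cycle⇒DirectedCycle Z)
             = contradiction twisted (⟶⇒¬Twisted (arcAt (Cycle.walk Z) i))

    open Semikernel (semikernel evenClosedWalks v₀) public

    walk-preserves-Available : ∀ {u v k} → Available u → Walk u v k → Available v
    walk-preserves-Available available ε       = available
    walk-preserves-Available _         (a ◅ p) = walk-preserves-Available (proj₁ (proj₂ a)) p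

    K-available : ∀ {v} → v ∈ₛ K → Available v
    K-available v∈K = walk-preserves-Available (v₀∈R , c∈L′v₀) (proj₂ (reachable v∈K))

    ∣R─K∣<∣R∣ : ∣ R ─ K ∣ < ∣ R ∣
    ∣R─K∣<∣R∣ = p∩q≢∅⇒∣p─q∣<∣p∣ R K
      (proj₁ nonempty , x∈p∩q⁺ (proj₁ (K-available (proj₂ nonempty)) , proj₂ nonempty))

    blockedAt : Vertex G → List Colour
    blockedAt w = concatMap (blockedBy c) (outArcsInto K w)

    length-blockedAt : ∀ w → length (blockedAt w) ≤ outdegInto K w
    length-blockedAt w = length-concatMap-≤ (blockedBy c) (length-blockedBy c) (outArcsInto K w)

    ∈-blockedAt : ∀ {w d} a → InD {G} D a → tail {G} a ≡ w → head {G} a ∈ₛ K →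
                  (d , c) ∈ arcColours a → d ∈ blockedAt w
    ∈-blockedAt a inD tail≡w head∈K dc = ∈-concatMap⁺ (blockedBy c)
      (lose (∈-filter⁺ _ (∈-filter⁺ _ (∈-arcs⁺ inD) tail≡w) head∈K) (∈-blockedBy a dc))

    L″ : Vertex G → List Colour
    L″ w = filter (λ d → ¬? (d ∈ᶜ? blockedAt w)) (L′ w)

    L″-avoids-K : ∀ {w d} → w ∈ₛ R ─ K → d ∈ L″ w →
                  ∀ a → tail {G} a ≡ w → head {G} a ∈ₛ K → (d , c) ∉ arcColours a
    L″-avoids-K {w} {d} w∈R─K d∈L″ a tail≡w head∈K dc
      with d∈L′ , d∉blocked ← ∈-filter⁻ (λ d → ¬? (d ∈ᶜ? blockedAt w)) {xs = L′ w} d∈L″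
      with InD-or-reverse a | d ℕ.≟ c
    ... | inj₁ inD | _ = d∉blocked (∈-blockedAt a inD tail≡w head∈K dc)
    ... | inj₂ _ | no d≢c = d∉blocked (∈-blockedAt a inD tail≡w head∈K dc)
      where
      inD : InD {G} D a
      inD = InED2⇒InD a (twisted⇒both _ λ straight → d≢c (straight-arcColours a straight dc))
    ... | inj₂ reverse-inD | yes refl
      with z , z∈K , back ← absorbing head∈K (x∈p─q⇒x∉q R K w∈R─K)
             (monochromatic-arc (reverse a) reverse-inD
               (K-available head∈K) (p─q⊆p R K w∈R─K , d∈L′)
               (tail-reverse a , trans (head-reverse a) tail≡w , diagonal-arcColours⁻ a dc))
      with b , b-inD , tail≡w′ , head≡z , cc ← arcOf back
      = d∉blocked (∈-blockedAt b b-inD tail≡w′ (subst (_∈ₛ K) (sym head≡z) z∈K)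
                    (diagonal-arcColours⁺ b cc))

    K-spans-no-monochromatic-edge : ∀ e → end₁ G e ∈ₛ K → end₂ G e ∈ₛ K → (c , c) ∉ C LC e
    K-spans-no-monochromatic-edge e e₁∈K e₂∈K cc with InD-or-reverse (e , forward)
    ... | inj₁ inD = independent e₁∈K e₂∈K
      (monochromatic-arc (e , forward) inD (K-available e₁∈K) (K-available e₂∈K) (refl , refl , cc))
    ... | inj₂ inD = independent e₂∈K e₁∈K
      (monochromatic-arc (e , backward) inD (K-available e₂∈K) (K-available e₁∈K) (refl , refl , cc))

    L″-large : (∀ v → Unique (L′ v)) →
               (∀ {v} → v ∈ₛ R → suc (outdegInto R v) ≤ length (L′ v)) →
               ∀ {w} → w ∈ₛ R ─ K → suc (outdegInto (R ─ K) w) ≤ length (L″ w)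
    L″-large unique large {w} w∈R─K = +-cancelʳ-≤ (outdegInto K w) _ _ (begin
      suc (outdegInto (R ─ K) w) + outdegInto K w
        ≡⟨ cong suc (sym (outdegInto-─ (λ x∈K → proj₁ (K-available x∈K)) w)) ⟩
      suc (outdegInto R w)
        ≤⟨ large (p─q⊆p R K w∈R─K) ⟩
      length (L′ w)
        ≤⟨ length≤filter-∉+length ℕ._≟_ (unique w) (blockedAt w) ⟩
      length (L″ w) + length (blockedAt w)
        ≤⟨ +-monoʳ-≤ (length (L″ w)) (length-blockedAt w) ⟩
      length (L″ w) + outdegInto K w ∎)
      where open ≤-Reasoning

  partialColouring : ∀ R L′ → Acc _<_ ∣ R ∣ → (∀ v → Unique (L′ v)) → (∀ v → L′ v ⊆ L LC v) →
                     (∀ {v} → v ∈ₛ R → suc (outdegInto R v) ≤ length (L′ v)) →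
                     PartialColouring R L′
  partialColouring R L′ (acc smaller) unique L′⊆L large with nonempty? R
  ... | no R-empty = (λ _ → 0) , (λ v∈R → contradiction (_ , v∈R) R-empty) ,
                     (λ e e₁∈R _ → contradiction (_ , e₁∈R) R-empty)
  ... | yes (v₀ , v₀∈R) with c , c∈L′v₀ ← 1≤length⇒∃∈ (≤-trans (s≤s z≤n) (large v₀∈R))
    = φ , φ-in-L′ , φ-proper
    where
    open Step R L′ L′⊆L c v₀ v₀∈R c∈L′v₀

    rest : PartialColouring (R ─ K) L″
    rest = partialColouring (R ─ K) L″ (smaller ∣R─K∣<∣R∣)
             (λ v → Unique.filter⁺ _ (unique v))
             (λ v d∈L″ → L′⊆L v (proj₁ (∈-filter⁻ _ d∈L″)))
             (L″-large unique large)

    φ′ : Vertex G → Colour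
    φ′ = proj₁ rest

    φ′-in-L″ : ∀ {v} → v ∈ₛ R → ¬ v ∈ₛ K → φ′ v ∈ L″ v
    φ′-in-L″ v∈R v∉K = proj₁ (proj₂ rest) (x∈p∧x∉q⇒x∈p─q v∈R v∉K)

    φ : Vertex G → Colour
    φ v with v ∈ₛ? K
    ... | yes _ = c
    ... | no _  = φ′ v

    φ-in-L′ : ∀ {v} → v ∈ₛ R → φ v ∈ L′ v
    φ-in-L′ {v} v∈R with v ∈ₛ? K
    ... | yes v∈K = proj₂ (K-available v∈K)
    ... | no v∉K  = proj₁ (∈-filter⁻ _ (φ′-in-L″ v∈R v∉K))

    φ-proper : ∀ e → end₁ G e ∈ₛ R → end₂ G e ∈ₛ R → (φ (end₁ G e) , φ (end₂ G e)) ∉ C LC e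
    φ-proper e e₁∈R e₂∈R with end₁ G e ∈ₛ? K | end₂ G e ∈ₛ? K
    ... | yes e₁∈K | yes e₂∈K = K-spans-no-monochromatic-edge e e₁∈K e₂∈K
    ... | yes e₁∈K | no e₂∉K  = λ conflict →
      L″-avoids-K (x∈p∧x∉q⇒x∈p─q e₂∈R e₂∉K) (φ′-in-L″ e₂∈R e₂∉K)
                  (e , backward) refl e₁∈K (∈-map⁺ swap conflict)
    ... | no e₁∉K  | yes e₂∈K =
      L″-avoids-K (x∈p∧x∉q⇒x∈p─q e₁∈R e₁∉K) (φ′-in-L″ e₁∈R e₁∉K) (e , forward) refl e₂∈K
    ... | no e₁∉K  | no e₂∉K  =
      proj₂ (proj₂ rest) e (x∈p∧x∉q⇒x∈p─q e₁∈R e₁∉K) (x∈p∧x∉q⇒x∈p─q e₂∈R e₂∉K)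

corollary3p2 : (G : Multigraph) (LC : CorrespondenceAssignment G) →
    IsDerangementAssignment LC →
    (D : Biorientation G) →
    (∀ e → Twisted LC e → InED2 {G} D e) →
    (∀ v → suc (outdeg {G} D v) ≤ length (L LC v)) →
    OddCyclesTwisted LC D →
    Colourable LC
corollary3p2 G LC derangement D twisted⇒both large oddCyclesTwisted =
  let φ , in-L , proper = partialColouring ⊤ (L LC) (<-wellFounded _) (L-unique LC) (λ _ → id) large⊤
  in φ , (λ _ → in-L ∈⊤) , (λ e → proper e ∈⊤ ∈⊤)
  where
  open KernelColouring G LC derangement D twisted⇒both oddCyclesTwisted
  open Arcs G D

  large⊤ : ∀ {v} → v ∈ₛ ⊤ → suc (outdegInto ⊤ v) ≤ length (L LC v)
  large⊤ {v} _ = subst (λ d → suc d ≤ length (L LC v)) (sym (outdegInto-⊤ v)) (large v)
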